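{- Let $\bm a\in\{(1,1,1,1),(1,1,1,2),(1,1,2,2),(1,2,2,2)\}$, let $A$ be the sum of the entries of $\bm a$, and put $B_{\bm a}=2,2,4,7$ according as $\bm a=(1,1,1,1),(1,1,1,2),(1,1,2,2),(1,2,2,2)$. Let $m\ge5$ be an integer and let $I$ be a closed interval of length at least $B_{\bm a}(m-2)$. Assume it is not the case that $m\equiv0\pmod 4$ and $\bm a\in\{(1,1,1,1),(1,1,2,2)\}$. Then for any integer $N$ there exists an integer $b\in I$ such that $N\equiv b\pmod{m-2}$ and $Ac-b^2\notin E_{\bm a}$, where $c=2\left(\frac{N-b}{m-2}\right)+b$.
   Context: The set $E_{\bm a}$ is: $\{2^{2s}(8t+7): s\in\mathbb{N}\cup\{0\}, t\in\mathbb{Z}\}$ if $\bm a=(1,1,1,1)$ or $(1,1,2,2)$; $\{5^{2s+2}(5t\pm2): s\in\mathbb{N}\cup\{0\},t\in\mathbb{Z}\}$ if $\bm a=(1,1,1,2)$; $\{2^{2s}(16t+14): s\in\mathbb{N}\cup\{0\},t\in\mathbb{Z}\}$ if $\bm a=(1,2,2,2)$. -}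

module Defs where

open import Data.Nat as ℕ using (ℕ)
open import Data.Integer as ℤ using (ℤ; +_; _+_; _-_; _*_; -_)
open import Data.Product using (∃; ∃-syntax; _×_; _,_)
open import Data.Sum using (_⊎_)
open import Relation.Binary.PropositionalEquality using (_≡_)

data Coeffs : Set where
  a1111 a1112 a1122 a1222 : Coeffs

A : Coeffs → ℕ
A a1111 = 4
A a1112 = 5
A a1122 = 6
A a1222 = 7

B : Coeffs → ℕ
B a1111 = 2
B a1112 = 2
B a1122 = 4
B a1222 = 7

InE : Coeffs → ℤ → Set
InE a1111 n = ∃[ s ] ∃[ t ] n ≡ (+ (2 ℕ.^ (2 ℕ.* s))) * (+ 8 * t + + 7)
InE a1122 n = ∃[ s ] ∃[ t ] n ≡ (+ (2 ℕ.^ (2 ℕ.* s))) * (+ 8 * t + + 7)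
InE a1112 n = ∃[ s ] ∃[ t ] (n ≡ (+ (5 ℕ.^ (2 ℕ.* s ℕ.+ 2))) * (+ 5 * t + + 2)
                            ⊎ n ≡ (+ (5 ℕ.^ (2 ℕ.* s ℕ.+ 2))) * (+ 5 * t - + 2))
InE a1222 n = ∃[ s ] ∃[ t ] n ≡ (+ (2 ℕ.^ (2 ℕ.* s))) * (+ 16 * t + + 14)

IsType1 : Coeffs → Set
IsType1 a = (a ≡ a1111) ⊎ (a ≡ a1122)

-- Put n = m − 2 and let b be the least integer ≥ x with b ≡ N (mod n). As I has length at least
-- B_a n, the integers b + j n with 0 ≤ j < B_a all lie in I, and passing from b to b + j n turns
-- k = (N − b)/n into k − j. Modulo 16, 25, 16 or 32 (according to a) the number Ac − b² depends only
-- on the residues of b, k and n, whereas E_a meets only a few residue classes (0, 7, 12, 15 mod 16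
-- for 4^s(8t+7)). An exhaustive check over all residues of b, k and n shows that some j < B_a avoids
-- these classes, which for a ∈ {(1,1,1,1), (1,1,2,2)} requires 4 ∤ m.

{-# OPTIONS --safe #-}
module Submission where

open import Defs
open import Data.Nat as ℕ using (ℕ; _≤_; _∸_; zero; suc; s≤s; NonZero; _^_)
open import Data.Nat.Divisibility using (_∣_; _∣?_; divides; ∣-trans; n∣m*n; ∣m∣n⇒∣m+n)
open import Data.Nat.DivMod using (m≡m%n+[m/n]*n)
import Data.Nat.Properties as ℕP
open import Data.Nat.Properties using (allUpTo?; anyUpTo?)
open import Data.Integer as ℤ using (ℤ; +_; +[1+_]; -[1+_]; _+_; _-_; _*_; -_; _%ℕ_; _/ℕ_)
import Data.Integer.Properties as ℤP
open import Data.Integer.DivMod using (a≡a%ℕn+[a/ℕn]*n; n%ℕd<d)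
open import Data.Integer.GCD using (gcd-zeroʳ)
open import Data.Integer.Tactic.RingSolver using (solve-∀)
open import Data.Rational as ℚ using (ℚ; mkℚ; _/_; ↥_; ↧_)
import Data.Rational.Properties as ℚP
import Data.Rational.Unnormalised as ℚᵘ
import Data.Rational.Unnormalised.Properties as ℚᵘP
open import Data.List using (List; []; _∷_)
open import Data.List.Membership.DecPropositional ℕ._≟_ using (_∈_; _∉_; _∈?_)
open import Data.Product using (∃-syntax; _×_; _,_; proj₁; proj₂)
open import Data.Sum using (inj₁; inj₂)
open import Data.Unit using (⊤; tt)
open import Data.Empty using (⊥-elim)
open import Relation.Nullary using (¬_; Dec; yes)
open import Relation.Nullary.Decidable using (True; toWitness; from-yes; ¬?; _→-dec_)
open import Relation.Binary.PropositionalEquality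

infix 4 _≡_mod_

record _≡_mod_ (i j : ℤ) (M : ℕ) : Set where
  constructor congruent
  field
    quotient : ℤ
    equation : i ≡ j + quotient * + M

open _≡_mod_

module _ {M : ℕ} where

  ≡-mod-refl : ∀ {i} → i ≡ i mod M
  ≡-mod-refl {i} = congruent (+ 0) (sym (ℤP.+-identityʳ i))

  ≡-mod-sym : ∀ {i j} → i ≡ j mod M → j ≡ i mod M
  ≡-mod-sym {i} {j} (congruent q i≡j+qM) =
    congruent (- q) (trans (move j q (+ M)) (cong (_+ - q * + M) (sym i≡j+qM)))
    where
    move : ∀ j q m → j ≡ (j + q * m) + - q * m
    move = solve-∀

  ≡-mod-trans : ∀ {i j k} → i ≡ j mod M → j ≡ k mod M → i ≡ k mod M
  ≡-mod-trans {k = k} (congruent q refl) (congruent r refl) = congruent (r + q) (collect k r q (+ M))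
    where
    collect : ∀ k r q m → (k + r * m) + q * m ≡ k + (r + q) * m
    collect = solve-∀

  +-cong-mod : ∀ {i i′ j j′} → i ≡ i′ mod M → j ≡ j′ mod M → i + j ≡ i′ + j′ mod M
  +-cong-mod {i′ = i′} {j′ = j′} (congruent q refl) (congruent r refl) =
    congruent (q + r) (collect i′ j′ q r (+ M))
    where
    collect : ∀ i j q r m → (i + q * m) + (j + r * m) ≡ (i + j) + (q + r) * m
    collect = solve-∀

  *-cong-mod : ∀ {i i′ j j′} → i ≡ i′ mod M → j ≡ j′ mod M → i * j ≡ i′ * j′ mod M
  *-cong-mod {i′ = i′} {j′ = j′} (congruent q refl) (congruent r refl) =
    congruent (q * j′ + i′ * r + q * r * + M) (expand i′ j′ q r (+ M))
    where
    expand : ∀ i j q r m → (i + q * m) * (j + r * m) ≡ i * j + (q * j + i * r + q * r * m) * m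
    expand = solve-∀

  -‿cong-mod : ∀ {i i′} → i ≡ i′ mod M → - i ≡ - i′ mod M
  -‿cong-mod {i′ = i′} (congruent q refl) = congruent (- q) (negate i′ q (+ M))
    where
    negate : ∀ i q m → - (i + q * m) ≡ - i + - q * m
    negate = solve-∀

  sub-cong-mod : ∀ {i i′ j j′} → i ≡ i′ mod M → j ≡ j′ mod M → i - j ≡ i′ - j′ mod M
  sub-cong-mod i≡i′ j≡j′ = +-cong-mod i≡i′ (-‿cong-mod j≡j′)

  module _ {{_ : NonZero M}} where

    ≡-mod-%ℕ : ∀ i → i ≡ + (i %ℕ M) mod M
    ≡-mod-%ℕ i = congruent (i /ℕ M) (a≡a%ℕn+[a/ℕn]*n i M)

    private
      ≡+[1+k]M⇒≥M : ∀ {r s k} → + r ≡ + s + +[1+ k ] * + M → M ℕ.≤ r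
      ≡+[1+k]M⇒≥M {r} {s} {k} eq = subst (M ℕ.≤_) (sym r≡s+[1+k]M)
        (ℕP.≤-trans (ℕP.m≤m+n M (k ℕ.* M)) (ℕP.m≤n+m _ s))
        where
        r≡s+[1+k]M : r ≡ s ℕ.+ suc k ℕ.* M
        r≡s+[1+k]M = ℤP.+-injective (trans eq (cong (_+_ (+ s)) (sym (ℤP.pos-* (suc k) M))))

    residue-unique : ∀ {r s} → r ℕ.< M → s ℕ.< M → + r ≡ + s mod M → r ≡ s
    residue-unique _ _ (congruent (+ zero) eq) = trans (ℤP.+-injective eq) (ℕP.+-identityʳ _)
    residue-unique r<M _ (congruent +[1+ k ] eq) = ⊥-elim (ℕP.<⇒≱ r<M (≡+[1+k]M⇒≥M {k = k} eq))
    residue-unique _ s<M r≡s@(congruent -[1+ k ] _) =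
      ⊥-elim (ℕP.<⇒≱ s<M (≡+[1+k]M⇒≥M {k = k} (equation (≡-mod-sym r≡s))))

    %ℕ-cong : ∀ {i j} → i ≡ j mod M → i %ℕ M ≡ j %ℕ M
    %ℕ-cong {i} {j} i≡j = residue-unique (n%ℕd<d i M) (n%ℕd<d j M)
      (≡-mod-trans (≡-mod-sym (≡-mod-%ℕ i)) (≡-mod-trans i≡j (≡-mod-%ℕ j)))

modulus : Coeffs → ℕ
modulus a1111 = 16
modulus a1112 = 25
modulus a1122 = 16
modulus a1222 = 32

modulus-nonZero : ∀ a → NonZero (modulus a)
modulus-nonZero a1111 = _
modulus-nonZero a1112 = _
modulus-nonZero a1122 = _
modulus-nonZero a1222 = _

residues : Coeffs → List ℕ
residues a1111 = 0 ∷ 7 ∷ 12 ∷ 15 ∷ []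
residues a1112 = 0 ∷ []
residues a1122 = 0 ∷ 7 ∷ 12 ∷ 15 ∷ []
residues a1222 = 0 ∷ 14 ∷ 24 ∷ 30 ∷ []

module _ {M : ℕ} {{_ : NonZero M}} (R : List ℕ) where

  affine-residue∈ : ∀ K α β → {True (allUpTo? (λ r → K * (α * + r + β) %ℕ M ∈? R) M)} →
                    ∀ {z} t → z ≡ K * (α * t + β) → z %ℕ M ∈ R
  affine-residue∈ K α β {all-residues} t refl =
    subst (_∈ R) (sym (%ℕ-cong reduce-t)) (toWitness all-residues (n%ℕd<d t M))
    where
    reduce-t : K * (α * t + β) ≡ K * (α * + (t %ℕ M) + β) mod M
    reduce-t = *-cong-mod (≡-mod-refl {i = K})
      (+-cong-mod (*-cong-mod (≡-mod-refl {i = α}) (≡-mod-%ℕ t)) (≡-mod-refl {i = β}))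

  multiple-residue∈ : {True ((+ 0) %ℕ M ∈? R)} → ∀ {z} q → z ≡ q * + M → z %ℕ M ∈ R
  multiple-residue∈ {zero∈R} q refl = subst (_∈ R) (sym (%ℕ-cong qM≡0)) (toWitness zero∈R)
    where
    qM≡0 : q * + M ≡ + 0 mod M
    qM≡0 = congruent q (sym (ℤP.+-identityˡ _))

scale-out : ∀ p c x → + (p ℕ.* c) * x ≡ (+ p * x) * + c
scale-out p c x = trans (cong (_* x) (ℤP.pos-* p c)) (commute (+ p) (+ c) x)
  where
  commute : ∀ p c x → (p * c) * x ≡ (p * x) * c
  commute = solve-∀

4^[2+s]≡4^s*16 : ∀ s → 2 ^ (2 ℕ.* (2 ℕ.+ s)) ≡ 2 ^ (2 ℕ.* s) ℕ.* 16
4^[2+s]≡4^s*16 s =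
  trans (cong (2 ^_) (trans (ℕP.*-distribˡ-+ 2 2 s) (ℕP.+-comm 4 (2 ℕ.* s))))
        (ℕP.^-distribˡ-+-* 2 (2 ℕ.* s) 4)

4^s[8t+7]-residue∈ : ∀ {z} s t → z ≡ + (2 ^ (2 ℕ.* s)) * (+ 8 * t + + 7) →
                     z %ℕ 16 ∈ 0 ∷ 7 ∷ 12 ∷ 15 ∷ []
4^s[8t+7]-residue∈ zero          t eq = affine-residue∈ _ (+ 1) (+ 8) (+ 7) t eq
4^s[8t+7]-residue∈ (suc zero)    t eq = affine-residue∈ _ (+ 4) (+ 8) (+ 7) t eq
4^s[8t+7]-residue∈ (suc (suc s)) t eq = multiple-residue∈ _ (+ (2 ^ (2 ℕ.* s)) * (+ 8 * t + + 7))
  (trans eq (trans (cong (λ c → + c * (+ 8 * t + + 7)) (4^[2+s]≡4^s*16 s))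
                   (scale-out (2 ^ (2 ℕ.* s)) 16 (+ 8 * t + + 7))))

4^s[16t+14]-residue∈ : ∀ {z} s t → z ≡ + (2 ^ (2 ℕ.* s)) * (+ 16 * t + + 14) →
                       z %ℕ 32 ∈ 0 ∷ 14 ∷ 24 ∷ 30 ∷ []
4^s[16t+14]-residue∈ zero          t eq = affine-residue∈ _ (+ 1) (+ 16) (+ 14) t eq
4^s[16t+14]-residue∈ (suc zero)    t eq = affine-residue∈ _ (+ 4) (+ 16) (+ 14) t eq
4^s[16t+14]-residue∈ (suc (suc s)) t eq = multiple-residue∈ _ (p * (+ 8 * t + + 7))
  (trans eq (trans (cong (λ c → + c * (+ 16 * t + + 14)) (4^[2+s]≡4^s*16 s))
                   (trans (scale-out (2 ^ (2 ℕ.* s)) 16 (+ 16 * t + + 14)) (halve p t))))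
  where
  p = + (2 ^ (2 ℕ.* s))
  halve : ∀ p t → (p * (+ 16 * t + + 14)) * + 16 ≡ (p * (+ 8 * t + + 7)) * + 32
  halve = solve-∀

25^[s+1]-residue∈ : ∀ {z} s x → z ≡ + (5 ^ (2 ℕ.* s ℕ.+ 2)) * x → z %ℕ 25 ∈ 0 ∷ []
25^[s+1]-residue∈ s x eq = multiple-residue∈ _ (+ (5 ^ (2 ℕ.* s)) * x)
  (trans eq (trans (cong (λ c → + c * x) (ℕP.^-distribˡ-+-* 5 (2 ℕ.* s) 2))
                   (scale-out (5 ^ (2 ℕ.* s)) 25 x)))

residue : Coeffs → ℤ → ℕ
residue a i = _%ℕ_ i (modulus a) {{modulus-nonZero a}}

residue<modulus : ∀ a i → residue a i ℕ.< modulus a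
residue<modulus a i = n%ℕd<d i (modulus a) {{modulus-nonZero a}}

≡-mod-residue : ∀ a i → i ≡ + residue a i mod modulus a
≡-mod-residue a = ≡-mod-%ℕ {{modulus-nonZero a}}

residue-cong : ∀ a {i j} → i ≡ j mod modulus a → residue a i ≡ residue a j
residue-cong a = %ℕ-cong {{modulus-nonZero a}}

InE⇒residue∈ : ∀ a {z} → InE a z → residue a z ∈ residues a
InE⇒residue∈ a1111 (s , t , eq)      = 4^s[8t+7]-residue∈ s t eq
InE⇒residue∈ a1122 (s , t , eq)      = 4^s[8t+7]-residue∈ s t eq
InE⇒residue∈ a1112 (s , t , inj₁ eq) = 25^[s+1]-residue∈ s _ eq
InE⇒residue∈ a1112 (s , t , inj₂ eq) = 25^[s+1]-residue∈ s _ eq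
InE⇒residue∈ a1222 (s , t , eq)      = 4^s[16t+14]-residue∈ s t eq

-- c = 2k + b, where k = (N − b)/(m − 2) is the quotient in the paper's definition of c.
Ac-b² : Coeffs → ℤ → ℤ → ℤ
Ac-b² a b k = + A a * (+ 2 * k + b) - b * b

Ac-b²-cong : ∀ a {M b b′ k k′} → b ≡ b′ mod M → k ≡ k′ mod M → Ac-b² a b k ≡ Ac-b² a b′ k′ mod M
Ac-b²-cong a b≡b′ k≡k′ = sub-cong-mod
  (*-cong-mod (≡-mod-refl {i = + A a}) (+-cong-mod (*-cong-mod (≡-mod-refl {i = + 2}) k≡k′) b≡b′))
  (*-cong-mod b≡b′ b≡b′)

-- n stands for m − 2; only for (1,1,1,1) and (1,1,2,2) does the search need m ≢ 0 (mod 4).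
Admissible : Coeffs → ℕ → Set
Admissible a1111 n = ¬ 4 ∣ 2 ℕ.+ n
Admissible a1122 n = ¬ 4 ∣ 2 ℕ.+ n
Admissible a1112 _ = ⊤
Admissible a1222 _ = ⊤

admissible? : ∀ a n → Dec (Admissible a n)
admissible? a1111 n = ¬? (4 ∣? 2 ℕ.+ n)
admissible? a1122 n = ¬? (4 ∣? 2 ℕ.+ n)
admissible? a1112 _ = yes tt
admissible? a1222 _ = yes tt

¬[4∣2+n×IsType1]⇒Admissible : ∀ a n → ¬ ((4 ∣ 2 ℕ.+ n) × IsType1 a) → Admissible a n
¬[4∣2+n×IsType1]⇒Admissible a1111 n ¬4∣m = λ 4∣m → ¬4∣m (4∣m , inj₁ refl)
¬[4∣2+n×IsType1]⇒Admissible a1122 n ¬4∣m = λ 4∣m → ¬4∣m (4∣m , inj₂ refl)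
¬[4∣2+n×IsType1]⇒Admissible a1112 n _   = tt
¬[4∣2+n×IsType1]⇒Admissible a1222 n _   = tt

4∣2+n%16⇒4∣2+n : ∀ n → 4 ∣ 2 ℕ.+ n ℕ.% 16 → 4 ∣ 2 ℕ.+ n
4∣2+n%16⇒4∣2+n n 4∣2+r =
  subst (4 ∣_) 2+n≡ (∣m∣n⇒∣m+n 4∣2+r (∣-trans (divides 4 refl) (n∣m*n (n ℕ./ 16))))
  where
  2+n≡ : 2 ℕ.+ n ℕ.% 16 ℕ.+ n ℕ./ 16 ℕ.* 16 ≡ 2 ℕ.+ n
  2+n≡ = trans (ℕP.+-assoc 2 (n ℕ.% 16) (n ℕ./ 16 ℕ.* 16))
               (cong (2 ℕ.+_) (sym (m≡m%n+[m/n]*n n 16)))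

admissible-residue : ∀ a {n} → Admissible a n → Admissible a (residue a (+ n))
admissible-residue a1111 {n} ¬4∣ = λ 4∣ → ¬4∣ (4∣2+n%16⇒4∣2+n n 4∣)
admissible-residue a1122 {n} ¬4∣ = λ 4∣ → ¬4∣ (4∣2+n%16⇒4∣2+n n 4∣)
admissible-residue a1112 _ = tt
admissible-residue a1222 _ = tt

ResidueChoice : Coeffs → Set
ResidueChoice a =
  ∀ {rb} → rb ℕ.< modulus a → ∀ {rk} → rk ℕ.< modulus a → ∀ {rn} → rn ℕ.< modulus a → Admissible a rn →
  ∃[ j ] j ℕ.< B a × residue a (Ac-b² a (+ rb + + j * + rn) (+ rk - + j)) ∉ residues a

residue-choice? : ∀ a → Dec (ResidueChoice a)
residue-choice? a =
  allUpTo? (λ rb → allUpTo? (λ rk → allUpTo? (λ rn → admissible? a rn →-dec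
    anyUpTo? (λ j → ¬? (residue a (Ac-b² a (+ rb + + j * + rn) (+ rk - + j)) ∈? residues a)) (B a))
    (modulus a)) (modulus a)) (modulus a)

residue-choice : ∀ a → ResidueChoice a
residue-choice a1111 = from-yes (residue-choice? a1111)
residue-choice a1112 = from-yes (residue-choice? a1112)
residue-choice a1122 = from-yes (residue-choice? a1122)
residue-choice a1222 = from-yes (residue-choice? a1222)

shift-avoiding-E : ∀ a {n} → Admissible a n → ∀ b k →
                   ∃[ j ] j ℕ.< B a × ¬ InE a (Ac-b² a (b + + j * + n) (k - + j))
shift-avoiding-E a {n} adm b k
  with residue-choice a (residue<modulus a b) (residue<modulus a k) (residue<modulus a (+ n))
                        (admissible-residue a adm)
... | j , j<B , ∉R =
  j , j<B , λ inE → ∉R (subst (_∈ residues a) (residue-cong a reduce) (InE⇒residue∈ a inE))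
  where
  reduce : Ac-b² a (b + + j * + n) (k - + j)
         ≡ Ac-b² a (+ residue a b + + j * + residue a (+ n)) (+ residue a k - + j) mod modulus a
  reduce = Ac-b²-cong a
    (+-cong-mod (≡-mod-residue a b) (*-cong-mod (≡-mod-refl {i = + j}) (≡-mod-residue a (+ n))))
    (sub-cong-mod (≡-mod-residue a k) (≡-mod-refl {i = + j}))

↥[i/1]≡i : ∀ i → ↥ (i / 1) ≡ i
↥[i/1]≡i i =
  trans (sym (ℤP.*-identityʳ _)) (trans (cong (↥ (i / 1) *_) (sym (gcd-zeroʳ i))) (ℚP.↥-/ i 1))

↧[i/1]≡1 : ∀ i → ↧ (i / 1) ≡ + 1
↧[i/1]≡1 i =
  trans (sym (ℤP.*-identityʳ _)) (trans (cong (↧ (i / 1) *_) (sym (gcd-zeroʳ i))) (ℚP.↧-/ i 1))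

p≤i/1 : ∀ {p} i → ↥ p ℤ.≤ i * ↧ p → p ℚ.≤ i / 1
p≤i/1 {p} i ↥p≤i↧p = ℚ.*≤* (begin
  ↥ p * ↧ (i / 1) ≡⟨ cong (↥ p *_) (↧[i/1]≡1 i) ⟩
  ↥ p * + 1       ≡⟨ ℤP.*-identityʳ (↥ p) ⟩
  ↥ p             ≤⟨ ↥p≤i↧p ⟩
  i * ↧ p         ≡⟨ cong (_* ↧ p) (↥[i/1]≡i i) ⟨
  ↥ (i / 1) * ↧ p ∎)
  where open ℤP.≤-Reasoning

i/1≤p : ∀ {p} i → i * ↧ p ℤ.≤ ↥ p → i / 1 ℚ.≤ p
i/1≤p {p} i i↧p≤↥p = ℚ.*≤* (begin
  ↥ (i / 1) * ↧ p ≡⟨ cong (_* ↧ p) (↥[i/1]≡i i) ⟩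
  i * ↧ p         ≤⟨ i↧p≤↥p ⟩
  ↥ p             ≡⟨ ℤP.*-identityʳ (↥ p) ⟨
  ↥ p * + 1       ≡⟨ cong (↥ p *_) (↧[i/1]≡1 i) ⟨
  ↥ p * ↧ (i / 1) ∎)
  where open ℤP.≤-Reasoning

-- q − p is normalised in ℚ; its image in ℚᵘ has the plain cross-multiplied numerator.
i/1≤q-p⇒ : ∀ p q i → i / 1 ℚ.≤ q ℚ.- p → i * (↧ q * ↧ p) ℤ.≤ ↥ q * ↧ p + - ↥ p * ↧ q
i/1≤q-p⇒ p@(mkℚ _ _ _) q@(mkℚ _ _ _) i i/1≤q-p
  with ℚᵘP.≤-respʳ-≃ (ℚᵘP.≃-trans (ℚP.toℚᵘ-homo-+ q (ℚ.- p)) (ℚᵘP.+-congʳ (ℚ.toℚᵘ q) (ℚP.toℚᵘ-homo‿- p)))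
                     (ℚP.toℚᵘ-mono-≤ i/1≤q-p)
... | ℚᵘ.*≤* cross = begin
  i * (↧ q * ↧ p)                             ≡⟨ cong (_* (↧ q * ↧ p)) ↥ᵘ[i/1]≡i ⟨
  ℚᵘ.↥ ℚ.toℚᵘ (i / 1) * (↧ q * ↧ p)           ≤⟨ cross ⟩
  (↥ q * ↧ p + - ↥ p * ↧ q) * ℚᵘ.↧ ℚ.toℚᵘ (i / 1) ≡⟨ cong ((↥ q * ↧ p + - ↥ p * ↧ q) *_) ↧ᵘ[i/1]≡1 ⟩
  (↥ q * ↧ p + - ↥ p * ↧ q) * + 1             ≡⟨ ℤP.*-identityʳ _ ⟩
  ↥ q * ↧ p + - ↥ p * ↧ q                     ∎
  where
  open ℤP.≤-Reasoning
  ↥ᵘ[i/1]≡i = trans (ℚP.↥ᵘ-toℚᵘ (i / 1)) (↥[i/1]≡i i)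
  ↧ᵘ[i/1]≡1 = trans (ℚP.↧ᵘ-toℚᵘ (i / 1)) (↧[i/1]≡1 i)

ceiling-multiple : ∀ P q .{{_ : NonZero q}} → ∃[ c ] P ℤ.≤ c * + q × c * + q ℤ.< P + + q
ceiling-multiple P q =
  - d , subst (P ℤ.≤_) (sym cq≡P+r) (ℤP.i≤i+j P (+ r)) ,
  subst (ℤ._< P + + q) (sym cq≡P+r) (ℤP.+-monoʳ-< P (ℤ.+<+ (n%ℕd<d (- P) q)))
  where
  r = (- P) %ℕ q
  d = (- P) /ℕ q
  cq≡P+r : - d * + q ≡ P + + r
  cq≡P+r = begin
    - d * + q                      ≡⟨ isolate P d (+ q) ⟩
    P + (- P - d * + q)            ≡⟨ cong (λ w → P + (w - d * + q)) (a≡a%ℕn+[a/ℕn]*n (- P) q) ⟩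
    P + ((+ r + d * + q) - d * + q) ≡⟨ cancel P (+ r) (d * + q) ⟩
    P + + r                        ∎
    where
    open ≡-Reasoning
    isolate : ∀ P d q → - d * q ≡ P + (- P - d * q)
    isolate = solve-∀
    cancel : ∀ P r e → P + ((r + e) - e) ≡ P + r
    cancel = solve-∀

least-in-class-above : ∀ P q n .{{_ : NonZero q}} .{{_ : NonZero n}} N →
  ∃[ b ] ∃[ k ] (N - b ≡ + n * k) × P ℤ.≤ b * + q × b * + q ℤ.< P + + n * + q
least-in-class-above P q n N with ceiling-multiple P q
... | c , P≤cq , cq<P+q = c + + e , k , N-b≡nk , P≤bq , bq<P+nq
  where
  open ℤP.≤-Reasoning
  e = (N - c) %ℕ n
  k = (N - c) /ℕ n
  N-b≡nk : N - (c + + e) ≡ + n * k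
  N-b≡nk = begin-equality
    N - (c + + e)         ≡⟨ regroup N c (+ e) ⟩
    (N - c) - + e         ≡⟨ cong (_- + e) (a≡a%ℕn+[a/ℕn]*n (N - c) n) ⟩
    (+ e + k * + n) - + e ≡⟨ cancel (+ e) k (+ n) ⟩
    + n * k               ∎
    where
    regroup : ∀ N c e → N - (c + e) ≡ (N - c) - e
    regroup = solve-∀
    cancel : ∀ e k n → (e + k * n) - e ≡ n * k
    cancel = solve-∀
  distrib : ∀ c e q → (c + e) * q ≡ c * q + e * q
  distrib = solve-∀
  P≤bq : P ℤ.≤ (c + + e) * + q
  P≤bq = begin
    P                    ≤⟨ P≤cq ⟩
    c * + q              ≤⟨ ℤP.i≤i+j (c * + q) (+ (e ℕ.* q)) ⟩
    c * + q + + (e ℕ.* q) ≡⟨ cong (_+_ (c * + q)) (ℤP.pos-* e q) ⟩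
    c * + q + + e * + q  ≡⟨ distrib c (+ e) (+ q) ⟨
    (c + + e) * + q      ∎
  bq<P+nq : (c + + e) * + q ℤ.< P + + n * + q
  bq<P+nq = begin-strict
    (c + + e) * + q           ≡⟨ distrib c (+ e) (+ q) ⟩
    c * + q + + e * + q       <⟨ ℤP.+-monoˡ-< (+ e * + q) cq<P+q ⟩
    P + + q + + e * + q       ≡⟨ collect P (+ e) (+ q) ⟩
    P + (+ 1 + + e) * + q     ≤⟨ ℤP.+-monoʳ-≤ P (ℤP.*-monoʳ-≤-nonNeg (+ q) (ℤ.+≤+ (n%ℕd<d (N - c) n))) ⟩
    P + + n * + q             ∎
    where
    collect : ∀ P e q → P + q + e * q ≡ P + (+ 1 + e) * q
    collect = solve-∀

progression-bounds : ∀ {P b} q n → P ℤ.≤ b * + q → b * + q ℤ.< P + + n * + q → ∀ {B j} → j ℕ.< B →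
  P ℤ.≤ (b + + j * + n) * + q × (b + + j * + n) * + q ℤ.< P + + (B ℕ.* n) * + q
progression-bounds {P} {b} q n P≤bq bq<P+nq {B} {j} j<B = lower , upper
  where
  open ℤP.≤-Reasoning
  lower : P ℤ.≤ (b + + j * + n) * + q
  lower = begin
    P                         ≤⟨ P≤bq ⟩
    b * + q                   ≤⟨ ℤP.*-monoʳ-≤-nonNeg (+ q) (ℤP.i≤i+j b (+ (j ℕ.* n))) ⟩
    (b + + (j ℕ.* n)) * + q   ≡⟨ cong (λ w → (b + w) * + q) (ℤP.pos-* j n) ⟩
    (b + + j * + n) * + q     ∎
  upper : (b + + j * + n) * + q ℤ.< P + + (B ℕ.* n) * + q
  upper = begin-strict
    (b + + j * + n) * + q             ≡⟨ distrib b (+ j) (+ n) (+ q) ⟩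
    b * + q + + j * + n * + q         <⟨ ℤP.+-monoˡ-< (+ j * + n * + q) bq<P+nq ⟩
    P + + n * + q + + j * + n * + q   ≡⟨ collect P (+ j) (+ n) (+ q) ⟩
    P + (+ 1 + + j) * + n * + q       ≤⟨ ℤP.+-monoʳ-≤ P [1+j]nq≤Bnq ⟩
    P + + B * + n * + q               ≡⟨ cong (λ w → P + w * + q) (ℤP.pos-* B n) ⟨
    P + + (B ℕ.* n) * + q             ∎
    where
    distrib : ∀ b j n q → (b + j * n) * q ≡ b * q + j * n * q
    distrib = solve-∀
    collect : ∀ P j n q → P + n * q + j * n * q ≡ P + (+ 1 + j) * n * q
    collect = solve-∀
    [1+j]nq≤Bnq : (+ 1 + + j) * + n * + q ℤ.≤ + B * + n * + q
    [1+j]nq≤Bnq = ℤP.*-monoʳ-≤-nonNeg (+ q) (ℤP.*-monoʳ-≤-nonNeg (+ n) (ℤ.+≤+ j<B))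

below-p+w⇒≤q : ∀ p q w i → w / 1 ℚ.≤ q ℚ.- p → i * ↧ p ℤ.< ↥ p + w * ↧ p → i / 1 ℚ.≤ q
below-p+w⇒≤q p@(mkℚ P _ _) q@(mkℚ R _ _) w i width i↧p<↥p+w↧p =
  i/1≤p i (ℤP.<⇒≤ (ℤP.*-cancelʳ-<-nonNeg (↧ p) (begin-strict
    i * ↧ q * ↧ p                   ≡⟨ swap i (↧ q) (↧ p) ⟩
    i * ↧ p * ↧ q                   <⟨ ℤP.*-monoʳ-<-pos (↧ q) i↧p<↥p+w↧p ⟩
    (P + w * ↧ p) * ↧ q             ≡⟨ expand P w (↧ p) (↧ q) ⟩
    P * ↧ q + w * (↧ q * ↧ p)       ≤⟨ ℤP.+-monoʳ-≤ (P * ↧ q) (i/1≤q-p⇒ p q w width) ⟩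
    P * ↧ q + (R * ↧ p + - P * ↧ q) ≡⟨ cancel P R (↧ p) (↧ q) ⟩
    R * ↧ p                         ∎)))
  where
  open ℤP.≤-Reasoning
  swap : ∀ i s q → i * s * q ≡ i * q * s
  swap = solve-∀
  expand : ∀ P w q s → (P + w * q) * s ≡ P * s + w * (s * q)
  expand = solve-∀
  cancel : ∀ P R q s → P * s + (R * q + - P * s) ≡ R * q
  cancel = solve-∀

progression-in-interval : (x y : ℚ) (B n : ℕ) .{{_ : NonZero n}} →
  + (B ℕ.* n) / 1 ℚ.≤ y ℚ.- x → (N : ℤ) → ∃[ b ] ∃[ k ] (N - b ≡ + n * k) ×
    (∀ {j} → j ℕ.< B → x ℚ.≤ (b + + j * + n) / 1 × (b + + j * + n) / 1 ℚ.≤ y)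
progression-in-interval x@(mkℚ P dx _) y B n width N with least-in-class-above P (suc dx) n N
... | b , k , N-b≡nk , P≤bq , bq<P+nq = b , k , N-b≡nk , λ {j} j<B →
  p≤i/1 (b + + j * + n) (proj₁ (bounds j<B)) ,
  below-p+w⇒≤q x y (+ (B ℕ.* n)) (b + + j * + n) width (proj₂ (bounds j<B))
  where
  bounds = progression-bounds {P} {b} (suc dx) n P≤bq bq<P+nq {B}

shift-class : ∀ {N b k} j n → N - b ≡ n * k → N - (b + j * n) ≡ n * (k - j)
shift-class {N} {b} {k} j n N-b≡nk = begin
  N - (b + j * n)   ≡⟨ regroup N b (j * n) ⟩
  (N - b) - j * n   ≡⟨ cong (_- j * n) N-b≡nk ⟩
  n * k - j * n     ≡⟨ factor n k j ⟩
  n * (k - j)       ∎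
  where
  open ≡-Reasoning
  regroup : ∀ N b e → N - (b + e) ≡ (N - b) - e
  regroup = solve-∀
  factor : ∀ n k j → n * k - j * n ≡ n * (k - j)
  factor = solve-∀

lemma4p3 : (a : Coeffs) (m : ℕ) → 5 ≤ m → (x y : ℚ) →
    (+ (B a ℕ.* (m ∸ 2))) / 1 ℚ.≤ y ℚ.- x →
    ¬ ((4 ∣ m) × IsType1 a) →
    (N : ℤ) →
    ∃[ b ] ∃[ k ] ((x ℚ.≤ b / 1) × (b / 1 ℚ.≤ y)
    × (N - b ≡ (+ (m ∸ 2)) * k)
    × ¬ InE a (+ (A a) * (+ 2 * k + b) - b * b))
lemma4p3 a (suc (suc (suc n))) (s≤s (s≤s (s≤s _))) x y width ¬4∣m N
  with progression-in-interval x y (B a) (suc n) width N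
... | b , k , N-b≡nk , in-interval
  with shift-avoiding-E a (¬[4∣2+n×IsType1]⇒Admissible a (suc n) ¬4∣m) b k
... | j , j<B , ∉E =
  b + + j * + suc n , k - + j , proj₁ (in-interval j<B) , proj₂ (in-interval j<B) ,
  shift-class {N} {b} (+ j) (+ suc n) N-b≡nk , ∉E
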